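{- Let $G$ be a connected circle graph with a split $A, B, \mathfrak{s}(A), \mathfrak{s}(B)$, let $\sim$ be the equivalence relation on $A \cup B$ defined below, and let $\Phi_1,\dots,\Phi_\ell$ be the equivalence classes of $\sim$ listed in an arbitrary circular order. For each $i$, let $\mathcal{R}_i$ be an arbitrary circle representation of the graph $G_i$ (defined below), and write its circular word as $v_i\,\tau_i\,v_i\,\hat\tau_i$. Then the circular word $$\tau_1\tau_2\cdots\tau_\ell\,\hat\tau_1\hat\tau_2\cdots\hat\tau_\ell$$ defines a circle representation of $G$.
   Context: A circle representation of a graph $G$ assigns to each vertex $v$ a chord $C_v$ of a fixed circle, all endpoints distinct, such that $C_u\cap C_v \ne\emptyset$ iff $uv\in E(G)$. Equivalently it is given by a circular word in which every vertex occurs exactly twice and $uv\in E(G)$ iff the occurrences of $u$ and $v$ alternate. A split of a connected graph $G$ is a partition of $V(G)$ into $A, B, \mathfrak{s}(A), \mathfrak{s}(B)$ with every $a\in A$ adjacent to every $b\in B$, no edges between $\mathfrak{s}(A)$ and $B\cup\mathfrak{s}(B)$ nor between $\mathfrak{s}(B)$ and $A\cup\mathfrak{s}(A)$, and $|A\cup\mathfrak{s}(A)|\ge2$, $|B\cup\mathfrak{s}(B)|\ge 2$. The relation $\sim$ on $A\cup B$ is the reflexive–transitive closure of the following two rules for $x,y\in A\cup B$: (C1) if $xy\notin E(G)$ then $x\sim y$; (C2) if $x$ and $y$ are connected by a path with at least one internal vertex and all internal vertices in $\mathfrak{s}(A)\cup\mathfrak{s}(B)$, then $x\sim y$. Each equivalence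 class is contained in $A$ or in $B$. For a class $\Phi$, $\mathfrak{s}(\Phi)$ denotes the set of all vertices of those connected components of $G\setminus(A\cup B)$ that contain a vertex adjacent to a vertex of $\Phi$. The graph $G_i$ is obtained from the subgraph of $G$ induced by $\Phi_i\cup\mathfrak{s}(\Phi_i)$ by adding a new vertex $v_i$ adjacent to all vertices of $\Phi_i$ and to no vertex of $\mathfrak{s}(\Phi_i)$ (equivalently, by contracting $V(G)\setminus(\Phi_i\cup\mathfrak{s}(\Phi_i))$ to a single vertex $v_i$). -}

module Defs where

open import Data.Nat using (ℕ)
open import Data.Fin using (Fin)
open import Data.Fin.Properties using (_≟_)
open import Data.Maybe using (Maybe; just; nothing)
import Data.Maybe.Properties as MaybeP
open import Data.List using (List; []; _∷_; _++_; length; filter; map; concat; tabulate)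
open import Data.Product using (Σ; ∃; ∃₂; _×_; _,_)
open import Data.Sum using (_⊎_)
open import Data.Unit using (⊤)
open import Data.Empty using (⊥)
open import Relation.Nullary using (¬_)
open import Relation.Binary.Definitions using (DecidableEquality)
open import Relation.Binary.PropositionalEquality using (_≡_; _≢_)
open import Relation.Binary.Construct.Closure.ReflexiveTransitive using (Star)
open import Function.Bundles using (_⇔_)

occ : ∀ {V : Set} → DecidableEquality V → V → List V → ℕ
occ eq v w = length (filter (λ x → eq x v) w)

record Graph (n : ℕ) : Set₁ where
  field
    Adj   : Fin n → Fin n → Set
    sym   : ∀ {x y} → Adj x y → Adj y x
    irrefl : ∀ {x} → ¬ Adj x x
open Graph public

Connected : ∀ {n} → Graph n → Set
Connected G = ∀ x y → Star (Adj G) x y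

-- Circle representations (circular words).
-- A circular word is represented by any of its linearisations (a list);
-- alternation of two letters is invariant under rotation.

Alternate : ∀ {V : Set} → DecidableEquality V → V → V → List V → Set
Alternate {V} eq u v w =
  Σ (List V) λ xs → Σ (List V) λ ys → Σ (List V) λ zs →
    (w ≡ xs ++ (u ∷ ys ++ (u ∷ zs))) × (occ eq v ys ≡ 1)

record CircleRep {V : Set} (eq : DecidableEquality V) (S : V → Set)
                 (E : V → V → Set) (w : List V) : Set where
  field
    occ-in  : ∀ v → S v → occ eq v w ≡ 2
    occ-out : ∀ v → ¬ S v → occ eq v w ≡ 0
    adj-alt : ∀ u v → S u → S v → u ≢ v → (E u v ⇔ Alternate eq u v w)

IsCircleGraph : ∀ {n} → Graph n → Set
IsCircleGraph {n} G = Σ (List (Fin n)) λ w → CircleRep _≟_ (λ _ → ⊤) (Adj G) w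

data Part : Set where
  pA pB psA psB : Part

SideA : Part → Set
SideA p = (p ≡ pA) ⊎ (p ≡ psA)

SideB : Part → Set
SideB p = (p ≡ pB) ⊎ (p ≡ psB)

InAB : Part → Set
InAB p = (p ≡ pA) ⊎ (p ≡ pB)

InS : Part → Set
InS p = (p ≡ psA) ⊎ (p ≡ psB)

record Split {n : ℕ} (G : Graph n) : Set where
  field
    part  : Fin n → Part
    AB-complete : ∀ a b → part a ≡ pA → part b ≡ pB → Adj G a b
    sA-iso : ∀ x y → part x ≡ psA → SideB (part y) → ¬ Adj G x y
    sB-iso : ∀ x y → part x ≡ psB → SideA (part y) → ¬ Adj G x y
    sizeA  : ∃₂ λ x y → x ≢ y × SideA (part x) × SideA (part y)
    sizeB  : ∃₂ λ x y → x ≢ y × SideB (part x) × SideB (part y)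
open Split public

module _ {n : ℕ} (G : Graph n) (sp : Split G) where

  inAB : Fin n → Set
  inAB x = InAB (part sp x)

  inS : Fin n → Set
  inS x = InS (part sp x)

  SEdge : Fin n → Fin n → Set
  SEdge x y = inS x × inS y × Adj G x y

  data Step : Fin n → Fin n → Set where
    C1 : ∀ {x y} → inAB x → inAB y → ¬ Adj G x y → Step x y
    C2 : ∀ {x y z w} → inAB x → inAB y →
         Adj G x z → inS z → Star SEdge z w → inS w → Adj G w y → Step x y

  _∼_ : Fin n → Fin n → Set
  _∼_ = Star Step

  -- Φ_i given by representatives r : Fin ℓ → Fin n listing all
  -- equivalence classes of ∼ exactly once each.
  record ClassEnumeration (ℓ : ℕ) (r : Fin ℓ → Fin n) : Set where
    field
      rep-AB   : ∀ i → inAB (r i)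
      distinct : ∀ i j → r i ∼ r j → i ≡ j
      covers   : ∀ x → inAB x → ∃ λ i → r i ∼ x

  InClass : Fin n → Fin n → Set
  InClass ρ x = inAB x × (ρ ∼ x)

  InSClass : Fin n → Fin n → Set
  InSClass ρ x = inS x × ∃₂ λ y z → InClass ρ y × inS z × Adj G y z × Star SEdge z x

  -- the graph G_i on Maybe (Fin n), with nothing playing the role of v_i
  GiVert : Fin n → Maybe (Fin n) → Set
  GiVert ρ nothing  = ⊤
  GiVert ρ (just x) = InClass ρ x ⊎ InSClass ρ x

  GiAdj : Fin n → Maybe (Fin n) → Maybe (Fin n) → Set
  GiAdj ρ nothing  nothing  = ⊥
  GiAdj ρ nothing  (just y) = InClass ρ y
  GiAdj ρ (just x) nothing  = InClass ρ x
  GiAdj ρ (just x) (just y) = Adj G x y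

wordGi : ∀ {n} → List (Fin n) → List (Fin n) → List (Maybe (Fin n))
wordGi τ τ̂ = nothing ∷ map just τ ++ (nothing ∷ map just τ̂)

Maybe≟ : ∀ {n} → DecidableEquality (Maybe (Fin n))
Maybe≟ = MaybeP.≡-dec _≟_

combined : ∀ {n ℓ} → (Fin ℓ → List (Fin n)) → (Fin ℓ → List (Fin n)) → List (Fin n)
combined τ τ̂ = concat (tabulate τ) ++ concat (tabulate τ̂)

-- Every vertex of G belongs to exactly one of the sets Φᵢ ∪ 𝔰(Φᵢ): a vertex of 𝔰(A)
-- reaches B ∪ 𝔰(B) by connectivity and can only leave 𝔰(A) through A ∪ B, while rule
-- (C2) forbids two classes to touch the same component of G \ (A ∪ B).  So each letter
-- occurs twice in τ₁⋯τ_ℓ τ̂₁⋯τ̂_ℓ, both times inside τᵢ and τ̂ᵢ for its own i.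
-- Whether u and v alternate only depends on the subword formed by the letters u and v.
-- If u and v belong to the same Gᵢ this subword is that of vᵢ τᵢ vᵢ τ̂ᵢ, where alternation
-- is adjacency in Gᵢ, hence in G.  Otherwise u ∈ Gᵢ, v ∈ Gⱼ with i ≠ j, the subword is
-- uᵃvᶜuᵇvᵈ or vᶜuᵃvᵈuᵇ, and u, v alternate iff a = c = 1, i.e. iff u alternates with vᵢ
-- and v with vⱼ, i.e. iff u ∈ Φᵢ and v ∈ Φⱼ; by (C1) and (C2) this is exactly when u and
-- v are adjacent.

module Submission where

open import Data.Empty using (⊥; ⊥-elim)
open import Data.Fin using (Fin; zero; suc; _<_)
open import Data.Fin.Properties using (_≟_; <-cmp)
import Data.Fin.Properties as Fin
open import Data.List using (List; []; _∷_; _++_; length; filter; map; replicate; concat; tabulate)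
open import Data.List.Properties
  using (∷-injective; ++-assoc; ++-identityʳ; length-++; map-++; filter-accept; filter-reject; filter-++; filter-all)
open import Data.List.Relation.Unary.All using (universal)
open import Data.List.Relation.Unary.All.Properties using (map⁺)
open import Data.Maybe using (Maybe; just; nothing)
open import Data.Maybe.Properties using (just-injective)
open import Data.Nat using (ℕ; zero; suc; _+_; s≤s)
import Data.Nat as ℕ
open import Data.Nat.Properties using (+-suc; +-comm; suc-injective; m+n≡0⇒m≡0; m+n≡0⇒n≡0)
open import Data.Product using (Σ-syntax; ∃; ∃₂; _×_; _,_; proj₁; proj₂; map₁; map₂)
open import Data.Product.Function.NonDependent.Propositional using (_×-⇔_)
open import Data.Sum using (_⊎_; inj₁; inj₂; [_,_]; swap)
open import Data.Unit using (⊤; tt)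
open import Function using (_∘_; _∘₂_; id; flip; case_of_)
open import Function.Bundles using (_⇔_; mk⇔; Equivalence)
open import Function.Definitions using (Injective)
open import Function.Properties.Equivalence using () renaming (sym to ⇔-sym; trans to ⇔-trans)
open import Function.Related.Propositional using (module EquationalReasoning)
open import Relation.Binary.Construct.Closure.ReflexiveTransitive using (Star; ε; _◅_; _◅◅_; reverse)
open import Relation.Binary.Definitions using (DecidableEquality; Tri; tri<; tri≈; tri>)
open import Relation.Binary.PropositionalEquality
  using (_≡_; _≢_; refl; sym; trans; cong; cong₂; subst; module ≡-Reasoning)
open import Relation.Nullary using (¬_; Dec; yes; no; ¬?)
import Relation.Nullary.Decidable as Dec
open import Relation.Nullary.Decidable using (_⊎-dec_)
open import Relation.Unary using (Pred; Decidable)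

open import Defs hiding (sym)

module _ {V : Set} (eq : DecidableEquality V) where

  occ-here : ∀ v w → occ eq v (v ∷ w) ≡ suc (occ eq v w)
  occ-here v w = cong length (filter-accept (λ x → eq x v) refl)

  occ-there : ∀ {x} v w → x ≢ v → occ eq v (x ∷ w) ≡ occ eq v w
  occ-there v w x≢v = cong length (filter-reject (λ x → eq x v) x≢v)

  occ-∷-cong : ∀ {x} y {l l′} → occ eq x l ≡ occ eq x l′ → occ eq x (y ∷ l) ≡ occ eq x (y ∷ l′)
  occ-∷-cong {x} y {l} {l′} e = case eq y x of λ where
    (yes refl) → trans (occ-here x l) (trans (cong suc e) (sym (occ-here x l′)))
    (no y≢x)   → trans (occ-there x l y≢x) (trans e (sym (occ-there x l′ y≢x)))

  occ-∷≡0 : ∀ {x} v w → occ eq v (x ∷ w) ≡ 0 → x ≢ v × occ eq v w ≡ 0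
  occ-∷≡0 {x} v w x∉ = case eq x v of λ where
    (yes refl) → case trans (sym (occ-here v w)) x∉ of λ ()
    (no x≢v)   → x≢v , trans (sym (occ-there v w x≢v)) x∉

  occ-++ : ∀ v xs ys → occ eq v (xs ++ ys) ≡ occ eq v xs + occ eq v ys
  occ-++ v xs ys = trans (cong length (filter-++ (λ x → eq x v) xs ys)) (length-++ (filter (λ x → eq x v) xs))

  occ-replicate : ∀ v k → occ eq v (replicate k v) ≡ k
  occ-replicate v zero    = refl
  occ-replicate v (suc k) = trans (occ-here v (replicate k v)) (cong suc (occ-replicate v k))

  occ-filter : ∀ {p} {P : Pred V p} (P? : Decidable P) {x} w → P x →
               occ eq x (filter P? w) ≡ occ eq x w
  occ-filter P? []      _  = refl
  occ-filter P? {x} (y ∷ w) px with P? y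
  ... | yes _  = occ-∷-cong y (occ-filter P? w px)
  ... | no ¬py = trans (occ-filter P? w px) (sym (occ-there x w λ { refl → ¬py px }))

  occ-twice : ∀ u xs ys zs →
              occ eq u (xs ++ u ∷ ys ++ u ∷ zs) ≡ 2 + (occ eq u xs + (occ eq u ys + occ eq u zs))
  occ-twice u xs ys zs = begin
    occ eq u (xs ++ u ∷ ys ++ u ∷ zs)  ≡⟨ occ-++ u xs _ ⟩
    a + occ eq u (u ∷ ys ++ u ∷ zs)    ≡⟨ cong (a +_) (occ-here u _) ⟩
    a + suc (occ eq u (ys ++ u ∷ zs))  ≡⟨ cong (λ t → a + suc t) (occ-++ u ys _) ⟩
    a + suc (b + occ eq u (u ∷ zs))    ≡⟨ cong (λ t → a + suc (b + t)) (occ-here u zs) ⟩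
    a + suc (b + suc c)                ≡⟨ +-suc a _ ⟩
    suc (a + (b + suc c))              ≡⟨ cong (λ t → suc (a + t)) (+-suc b c) ⟩
    suc (a + suc (b + c))              ≡⟨ cong suc (+-suc a _) ⟩
    2 + (a + (b + c))                  ∎
    where
    open ≡-Reasoning
    a = occ eq u xs
    b = occ eq u ys
    c = occ eq u zs

  occ-twice≡2⇒prefix-gap-free : ∀ u xs ys zs → occ eq u (xs ++ u ∷ ys ++ u ∷ zs) ≡ 2 →
                                occ eq u xs ≡ 0 × occ eq u ys ≡ 0
  occ-twice≡2⇒prefix-gap-free u xs ys zs twice =
    m+n≡0⇒m≡0 _ rest , m+n≡0⇒m≡0 _ (m+n≡0⇒n≡0 (occ eq u xs) rest)
    where
    rest = suc-injective (suc-injective (trans (sym (occ-twice u xs ys zs)) twice))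

  first-occurrence-unique : ∀ u {xs xs′ zs zs′} → occ eq u xs ≡ 0 → occ eq u xs′ ≡ 0 →
                            xs ++ u ∷ zs ≡ xs′ ++ u ∷ zs′ → xs ≡ xs′ × zs ≡ zs′
  first-occurrence-unique u {[]}     {[]}       _   _    refl = refl , refl
  first-occurrence-unique u {[]}     {_ ∷ xs′}  _   u∉′  refl = ⊥-elim (proj₁ (occ-∷≡0 u xs′ u∉′) refl)
  first-occurrence-unique u {_ ∷ xs} {[]}       u∉  _    refl = ⊥-elim (proj₁ (occ-∷≡0 u xs u∉) refl)
  first-occurrence-unique u {x ∷ xs} {_ ∷ xs′} u∉ u∉′ e with ∷-injective e
  ... | refl , e′ = map₁ (cong (x ∷_))
    (first-occurrence-unique u (proj₂ (occ-∷≡0 u xs u∉)) (proj₂ (occ-∷≡0 u xs′ u∉′)) e′)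

  split-at-occurrence : ∀ u w {k} → occ eq u w ≡ suc k →
                        Σ[ xs ∈ List V ] Σ[ zs ∈ List V ] w ≡ xs ++ u ∷ zs × occ eq u zs ≡ k
  split-at-occurrence u (x ∷ w) occurs with eq x u
  ... | yes refl = [] , w , refl , suc-injective occurs
  ... | no _ with split-at-occurrence u w occurs
  ...   | xs , zs , refl , rest = x ∷ xs , zs , refl , rest

  split-twice : ∀ u w → occ eq u w ≡ 2 →
                Σ[ xs ∈ List V ] Σ[ ys ∈ List V ] Σ[ zs ∈ List V ] w ≡ xs ++ u ∷ ys ++ u ∷ zs
  split-twice u w twice with split-at-occurrence u w twice
  ... | xs , rest , refl , once with split-at-occurrence u rest once
  ...   | ys , zs , refl , _ = xs , ys , zs , refl

  alternate⇔gap : ∀ {u v w} xs ys zs → w ≡ xs ++ u ∷ ys ++ u ∷ zs → occ eq u w ≡ 2 →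
                  Alternate eq u v w ⇔ occ eq v ys ≡ 1
  alternate⇔gap {u} {v} xs ys zs refl twice = mk⇔ to (λ once → xs , ys , zs , refl , once)
    where
    to : Alternate eq u v (xs ++ u ∷ ys ++ u ∷ zs) → occ eq v ys ≡ 1
    to (xs′ , ys′ , zs′ , e , once) = subst (λ gap → occ eq v gap ≡ 1) (sym ys≡ys′) once
      where
      free   = occ-twice≡2⇒prefix-gap-free u xs ys zs twice
      free′  = occ-twice≡2⇒prefix-gap-free u xs′ ys′ zs′ (subst (λ t → occ eq u t ≡ 2) e twice)
      after  = proj₂ (first-occurrence-unique u (proj₁ free) (proj₁ free′) e)
      ys≡ys′ = proj₁ (first-occurrence-unique u (proj₂ free) (proj₂ free′) after)

  alternate? : ∀ u v w → occ eq u w ≡ 2 → Dec (Alternate eq u v w)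
  alternate? u v w twice with split-twice u w twice
  ... | xs , ys , zs , e = Dec.map (⇔-sym (alternate⇔gap xs ys zs e twice)) (occ eq v ys ℕ.≟ 1)

  adjacent-not-alternate : ∀ {u v w} xs zs → w ≡ xs ++ u ∷ u ∷ zs → occ eq u w ≡ 2 →
                           ¬ Alternate eq u v w
  adjacent-not-alternate xs zs e twice alt =
    case Equivalence.to (alternate⇔gap xs [] zs e twice) alt of λ ()

  alternate-filter : ∀ {p} {P : Pred V p} (P? : Decidable P) {u v} w → P u → P v →
                     occ eq u w ≡ 2 → Alternate eq u v w ⇔ Alternate eq u v (filter P? w)
  alternate-filter P? {u} {v} w pu pv twice with split-twice u w twice
  ... | xs , ys , zs , refl = begin
    Alternate eq u v (xs ++ u ∷ ys ++ u ∷ zs)  ∼⟨ alternate⇔gap xs ys zs refl twice ⟩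
    occ eq v ys ≡ 1                            ≡⟨ cong (_≡ 1) (occ-filter P? ys pv) ⟨
    occ eq v (filter P? ys) ≡ 1
      ∼⟨ ⇔-sym (alternate⇔gap (filter P? xs) (filter P? ys) (filter P? zs) split twice′) ⟩
    Alternate eq u v (filter P? (xs ++ u ∷ ys ++ u ∷ zs)) ∎
    where
    open EquationalReasoning
    split : filter P? (xs ++ u ∷ ys ++ u ∷ zs) ≡ filter P? xs ++ u ∷ filter P? ys ++ u ∷ filter P? zs
    split = trans (filter-++ P? xs _) (cong (filter P? xs ++_)
              (trans (filter-accept P? pu) (cong (u ∷_)
                (trans (filter-++ P? ys _) (cong (filter P? ys ++_) (filter-accept P? pu))))))
    twice′ : occ eq u (filter P? (xs ++ u ∷ ys ++ u ∷ zs)) ≡ 2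
    twice′ = trans (occ-filter P? (xs ++ u ∷ ys ++ u ∷ zs) pu) twice

  IsEither : V → V → Pred V _
  IsEither u v x = x ≡ u ⊎ x ≡ v

  isEither? : ∀ u v → Decidable (IsEither u v)
  isEither? u v x = eq x u ⊎-dec eq x v

  filter-one-letter : ∀ {p} {P : Pred V p} (P? : Decidable P) {u v} →
                      (∀ {x} → P x → IsEither u v x) → P u →
                      ∀ w → occ eq v w ≡ 0 → filter P? w ≡ replicate (occ eq u w) u
  filter-one-letter P? onto pu []      _ = refl
  filter-one-letter P? {u} {v} onto pu (x ∷ w) x∷w∌v = case eq x u of λ where
      (yes refl) → trans (filter-accept P? pu)
                     (trans (cong (u ∷_) rest) (cong (λ k → replicate k u) (sym (occ-here u w))))
      (no x≢u)   → trans (filter-reject P? ([ x≢u , proj₁ x≢v,w∌v ] ∘ onto))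
                     (trans rest (cong (λ k → replicate k u) (sym (occ-there u w x≢u))))
    where
    x≢v,w∌v = occ-∷≡0 v w x∷w∌v
    rest    = filter-one-letter P? onto pu w (proj₂ x≢v,w∌v)

  filter-isEither-left : ∀ u v w → occ eq v w ≡ 0 → filter (isEither? u v) w ≡ replicate (occ eq u w) u
  filter-isEither-left u v = filter-one-letter (isEither? u v) id (inj₁ refl)

  filter-isEither-right : ∀ u v w → occ eq u w ≡ 0 → filter (isEither? u v) w ≡ replicate (occ eq v w) v
  filter-isEither-right u v = filter-one-letter (isEither? u v) swap (inj₂ refl)

  filter-isEither-absent : ∀ u v w → occ eq u w ≡ 0 → occ eq v w ≡ 0 → filter (isEither? u v) w ≡ []
  filter-isEither-absent u v w w∌u w∌v =
    trans (filter-isEither-left u v w w∌v) (cong (λ k → replicate k u) w∌u)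

  alternate-uᵃvᶜ-uᵇvᵈ : ∀ {u v} a b c d → a + b ≡ 2 →
    occ eq u ((replicate a u ++ replicate c v) ++ (replicate b u ++ replicate d v)) ≡ 2 →
    Alternate eq u v ((replicate a u ++ replicate c v) ++ (replicate b u ++ replicate d v)) ⇔
    (a ≡ 1 × c ≡ 1)
  alternate-uᵃvᶜ-uᵇvᵈ {v = v} 0 _ c d refl twice =
    mk⇔ (⊥-elim ∘ adjacent-not-alternate (replicate c v) (replicate d v) refl twice) λ ()
  alternate-uᵃvᶜ-uᵇvᵈ {u} {v} 1 _ c d refl twice = begin
    Alternate eq u v (u ∷ replicate c v ++ u ∷ replicate d v)
      ∼⟨ alternate⇔gap [] (replicate c v) (replicate d v) refl twice ⟩
    occ eq v (replicate c v) ≡ 1  ≡⟨ cong (_≡ 1) (occ-replicate v c) ⟩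
    c ≡ 1                         ∼⟨ mk⇔ (refl ,_) proj₂ ⟩
    (1 ≡ 1 × c ≡ 1)               ∎
    where open EquationalReasoning
  alternate-uᵃvᶜ-uᵇvᵈ {v = v} 2 _ c d refl twice =
    mk⇔ (⊥-elim ∘ adjacent-not-alternate [] (replicate c v ++ replicate d v) refl twice) λ ()

  alternate-vᶜuᵃ-vᵈuᵇ : ∀ {u v} a b c d → a + b ≡ 2 → c + d ≡ 2 →
    occ eq u ((replicate c v ++ replicate a u) ++ (replicate d v ++ replicate b u)) ≡ 2 →
    Alternate eq u v ((replicate c v ++ replicate a u) ++ (replicate d v ++ replicate b u)) ⇔
    (a ≡ 1 × c ≡ 1)
  alternate-vᶜuᵃ-vᵈuᵇ {u} {v} 0 _ c d refl _ twice =
    mk⇔ (⊥-elim ∘ adjacent-not-alternate ((C ++ []) ++ D) [] (sym (++-assoc (C ++ []) D (u ∷ u ∷ []))) twice) λ ()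
    where C = replicate c v ; D = replicate d v
  alternate-vᶜuᵃ-vᵈuᵇ {u} {v} 1 _ c d refl c+d≡2 twice = begin
    Alternate eq u v ((C ++ u ∷ []) ++ (D ++ u ∷ []))
      ∼⟨ alternate⇔gap C D [] (++-assoc C (u ∷ []) _) twice ⟩
    occ eq v D ≡ 1   ≡⟨ cong (_≡ 1) (occ-replicate v d) ⟩
    d ≡ 1            ∼⟨ mk⇔ (λ { refl → refl , suc-injective (trans (+-comm 1 c) c+d≡2) })
                            (λ { (_ , refl) → suc-injective c+d≡2 }) ⟩
    (1 ≡ 1 × c ≡ 1)  ∎
    where
    open EquationalReasoning
    C = replicate c v ; D = replicate d v
  alternate-vᶜuᵃ-vᵈuᵇ {u} {v} 2 _ c d refl _ twice =
    mk⇔ (⊥-elim ∘ adjacent-not-alternate C (D ++ []) (++-assoc C (u ∷ u ∷ []) _) twice) λ ()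
    where C = replicate c v ; D = replicate d v

module _ {A B : Set} (eqA : DecidableEquality A) (eqB : DecidableEquality B)
         {f : A → B} (f-injective : Injective _≡_ _≡_ f) where

  occ-map : ∀ x l → occ eqB (f x) (map f l) ≡ occ eqA x l
  occ-map x []      = refl
  occ-map x (y ∷ l) = case eqA y x of λ where
    (yes refl) → trans (occ-here eqB (f y) _) (trans (cong suc (occ-map x l)) (sym (occ-here eqA y l)))
    (no y≢x)   → trans (occ-there eqB (f x) _ (y≢x ∘ f-injective))
                       (trans (occ-map x l) (sym (occ-there eqA x l y≢x)))

  alternate-map : ∀ u v l → occ eqA u l ≡ 2 →
                  Alternate eqB (f u) (f v) (map f l) ⇔ Alternate eqA u v l
  alternate-map u v l twice with split-twice eqA u l twice
  ... | xs , ys , zs , refl = begin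
    Alternate eqB (f u) (f v) (map f (xs ++ u ∷ ys ++ u ∷ zs))
      ∼⟨ alternate⇔gap eqB (map f xs) (map f ys) (map f zs) split twice′ ⟩
    occ eqB (f v) (map f ys) ≡ 1  ≡⟨ cong (_≡ 1) (occ-map v ys) ⟩
    occ eqA v ys ≡ 1              ∼⟨ ⇔-sym (alternate⇔gap eqA xs ys zs refl twice) ⟩
    Alternate eqA u v (xs ++ u ∷ ys ++ u ∷ zs) ∎
    where
    open EquationalReasoning
    split : map f (xs ++ u ∷ ys ++ u ∷ zs) ≡ map f xs ++ f u ∷ map f ys ++ f u ∷ map f zs
    split = trans (map-++ f xs _) (cong (λ t → map f xs ++ f u ∷ t) (map-++ f ys _))
    twice′ : occ eqB (f u) (map f (xs ++ u ∷ ys ++ u ∷ zs)) ≡ 2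
    twice′ = trans (occ-map u (xs ++ u ∷ ys ++ u ∷ zs)) twice

module _ {A : Set} where

  length≡0⇒≡[] : ∀ {xs : List A} → length xs ≡ 0 → xs ≡ []
  length≡0⇒≡[] {[]} _ = refl

  filter-concat-tabulate : ∀ {p} {P : Pred A p} (P? : Decidable P) {ℓ} (σ : Fin ℓ → List A) →
                           filter P? (concat (tabulate σ)) ≡ concat (tabulate (filter P? ∘ σ))
  filter-concat-tabulate P? {zero}  σ = refl
  filter-concat-tabulate P? {suc ℓ} σ =
    trans (filter-++ P? (σ zero) _) (cong (filter P? (σ zero) ++_) (filter-concat-tabulate P? (σ ∘ suc)))

  concat-tabulate-[] : ∀ {ℓ} (σ : Fin ℓ → List A) → (∀ k → σ k ≡ []) → concat (tabulate σ) ≡ []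
  concat-tabulate-[] {zero}  σ empty = refl
  concat-tabulate-[] {suc ℓ} σ empty =
    trans (cong (_++ concat (tabulate (σ ∘ suc))) (empty zero)) (concat-tabulate-[] (σ ∘ suc) (empty ∘ suc))

  concat-tabulate-single : ∀ {ℓ} (σ : Fin ℓ → List A) i → (∀ k → k ≢ i → σ k ≡ []) →
                           concat (tabulate σ) ≡ σ i
  concat-tabulate-single σ zero    outside =
    trans (cong (σ zero ++_) (concat-tabulate-[] (σ ∘ suc) λ k → outside (suc k) λ ()))
          (++-identityʳ (σ zero))
  concat-tabulate-single σ (suc i) outside =
    trans (cong (_++ concat (tabulate (σ ∘ suc))) (outside zero λ ()))
          (concat-tabulate-single (σ ∘ suc) i λ k k≢i → outside (suc k) (k≢i ∘ Fin.suc-injective))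

  concat-tabulate-pair : ∀ {ℓ} (σ : Fin ℓ → List A) {i j} → i < j →
                         (∀ k → k ≢ i → k ≢ j → σ k ≡ []) → concat (tabulate σ) ≡ σ i ++ σ j
  concat-tabulate-pair σ {zero}  {suc j} _ outside =
    cong (σ zero ++_)
         (concat-tabulate-single (σ ∘ suc) j λ k k≢j → outside (suc k) (λ ()) (k≢j ∘ Fin.suc-injective))
  concat-tabulate-pair σ {suc i} {suc j} (s≤s i<j) outside =
    trans (cong (_++ concat (tabulate (σ ∘ suc))) (outside zero (λ ()) (λ ())))
          (concat-tabulate-pair (σ ∘ suc) i<j λ k k≢i k≢j →
             outside (suc k) (k≢i ∘ Fin.suc-injective) (k≢j ∘ Fin.suc-injective))

occ-concat-tabulate-single : ∀ {V : Set} (eq : DecidableEquality V) {ℓ} (σ : Fin ℓ → List V) i x →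
                             (∀ k → k ≢ i → occ eq x (σ k) ≡ 0) →
                             occ eq x (concat (tabulate σ)) ≡ occ eq x (σ i)
occ-concat-tabulate-single eq σ i x absent =
  cong length (trans (filter-concat-tabulate (λ y → eq y x) σ)
                     (concat-tabulate-single _ i λ k k≢i → length≡0⇒≡[] (absent k k≢i)))

adjacency? : ∀ {V : Set} (eq : DecidableEquality V) {S : V → Set} {E : V → V → Set} {w} →
             CircleRep eq S E w → (∀ {x} → ¬ E x x) → ∀ {u v} → S u → S v → Dec (E u v)
adjacency? eq {w = w} rep irreflexive {u} {v} u∈S v∈S = case eq u v of λ where
  (yes refl) → no irreflexive
  (no u≢v)   → Dec.map (⇔-sym (CircleRep.adj-alt rep u v u∈S v∈S u≢v))
                       (alternate? eq u v w (CircleRep.occ-in rep u u∈S))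

module _ {n : ℕ} where

  nonNothing? : Decidable (λ (m : Maybe (Fin n)) → m ≢ nothing)
  nonNothing? m = ¬? (Maybe≟ m nothing)

  filter-wordGi : ∀ (τ τ̂ : List (Fin n)) → filter nonNothing? (wordGi τ τ̂) ≡ map just (τ ++ τ̂)
  filter-wordGi τ τ̂ = begin
    filter nonNothing? (nothing ∷ map just τ ++ nothing ∷ map just τ̂)
      ≡⟨ filter-reject nonNothing? {xs = map just τ ++ nothing ∷ map just τ̂} (λ ne → ne refl) ⟩
    filter nonNothing? (map just τ ++ nothing ∷ map just τ̂)
      ≡⟨ filter-++ nonNothing? (map just τ) _ ⟩
    filter nonNothing? (map just τ) ++ filter nonNothing? (nothing ∷ map just τ̂)
      ≡⟨ cong (filter nonNothing? (map just τ) ++_) (filter-reject nonNothing? {xs = map just τ̂} (λ ne → ne refl)) ⟩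
    filter nonNothing? (map just τ) ++ filter nonNothing? (map just τ̂)
      ≡⟨ cong₂ _++_ (keep-all τ) (keep-all τ̂) ⟩
    map just τ ++ map just τ̂
      ≡⟨ map-++ just τ τ̂ ⟨
    map just (τ ++ τ̂) ∎
    where
    open ≡-Reasoning
    keep-all : ∀ l → filter nonNothing? (map just l) ≡ map just l
    keep-all l = filter-all nonNothing? (map⁺ (universal (λ _ ()) l))

  occ-wordGi : ∀ x (τ τ̂ : List (Fin n)) → occ Maybe≟ (just x) (wordGi τ τ̂) ≡ occ _≟_ x (τ ++ τ̂)
  occ-wordGi x τ τ̂ = begin
    occ Maybe≟ (just x) (wordGi τ τ̂)                      ≡⟨ occ-filter Maybe≟ nonNothing? (wordGi τ τ̂) (λ ()) ⟨
    occ Maybe≟ (just x) (filter nonNothing? (wordGi τ τ̂)) ≡⟨ cong (occ Maybe≟ (just x)) (filter-wordGi τ τ̂) ⟩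
    occ Maybe≟ (just x) (map just (τ ++ τ̂))               ≡⟨ occ-map _≟_ Maybe≟ just-injective x (τ ++ τ̂) ⟩
    occ _≟_ x (τ ++ τ̂)                                    ∎
    where open ≡-Reasoning

AB-disjoint-S : ∀ {p} → InAB p → InS p → ⊥
AB-disjoint-S (inj₁ refl) (inj₁ ())
AB-disjoint-S (inj₁ refl) (inj₂ ())
AB-disjoint-S (inj₂ refl) (inj₁ ())
AB-disjoint-S (inj₂ refl) (inj₂ ())

SideA-≢-psB : ∀ {p} → SideA p → p ≢ psB
SideA-≢-psB (inj₁ refl) ()
SideA-≢-psB (inj₂ refl) ()

SideB-≢-psA : ∀ {p} → SideB p → p ≢ psA
SideB-≢-psA (inj₁ refl) ()
SideB-≢-psA (inj₂ refl) ()

module SplitPaths {n} (G : Graph n) (sp : Split G) where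

  SEdge-sym : ∀ {x y} → SEdge G sp x y → SEdge G sp y x
  SEdge-sym (x∈S , y∈S , x~y) = y∈S , x∈S , Graph.sym G x~y

  Step-sym : ∀ {x y} → Step G sp x y → Step G sp y x
  Step-sym (C1 x∈AB y∈AB x≁y) = C1 y∈AB x∈AB (x≁y ∘ Graph.sym G)
  Step-sym (C2 x∈AB y∈AB x~z z∈S z⇝w w∈S w~y) =
    C2 y∈AB x∈AB (Graph.sym G w~y) w∈S (reverse SEdge-sym z⇝w) z∈S (Graph.sym G x~z)

  ∼-sym : ∀ {x y} → _∼_ G sp x y → _∼_ G sp y x
  ∼-sym = reverse Step-sym

  S-neighbour : ∀ {x y} → inS G sp x → Adj G x y → part sp y ≡ part sp x ⊎ inAB G sp y
  S-neighbour {x} {y} (inj₁ x∈sA) x~y with part sp y in y-part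
  ... | pA  = inj₂ (inj₁ refl)
  ... | pB  = inj₂ (inj₂ refl)
  ... | psA = inj₁ (sym x∈sA)
  ... | psB = ⊥-elim (sA-iso sp x y x∈sA (inj₂ y-part) x~y)
  S-neighbour {x} {y} (inj₂ x∈sB) x~y with part sp y in y-part
  ... | pA  = inj₂ (inj₁ refl)
  ... | pB  = inj₂ (inj₂ refl)
  ... | psA = ⊥-elim (sB-iso sp x y x∈sB (inj₂ y-part) x~y)
  ... | psB = inj₁ (sym x∈sB)

  ExitToAB : Fin n → Set
  ExitToAB a = ∃₂ λ z y → Star (SEdge G sp) a z × inS G sp z × Adj G z y × inAB G sp y

  exit : ∀ {a b} → inS G sp a → Star (Adj G) a b → part sp b ≢ part sp a → ExitToAB a
  exit a∈S ε b≢a = ⊥-elim (b≢a refl)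
  exit a∈S (a~c ◅ c⇝b) b≢a with S-neighbour a∈S a~c
  ... | inj₂ c∈AB   = _ , _ , ε , a∈S , a~c , c∈AB
  ... | inj₁ c-part =
    let c∈S = subst InS (sym c-part) a∈S
        z , y , c⇝z , exit-from-z = exit c∈S c⇝b (b≢a ∘ flip trans c-part)
    in  z , y , (a∈S , c∈S , a~c) ◅ c⇝z , exit-from-z

module Classes {n} {G : Graph n} {sp : Split G} {ℓ} {r : Fin ℓ → Fin n}
               (classes : ClassEnumeration G sp ℓ r) where

  open ClassEnumeration classes
  open SplitPaths G sp

  Home : Fin ℓ → Fin n → Set
  Home i x = GiVert G sp (r i) (just x)

  class-unique : ∀ {i j x} → InClass G sp (r i) x → InClass G sp (r j) x → i ≡ j
  class-unique {i} {j} (_ , ri∼x) (_ , rj∼x) = distinct i j (ri∼x ◅◅ ∼-sym rj∼x)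

  class-nonadjacent : ∀ {i j x y} → InClass G sp (r i) x → InClass G sp (r j) y →
                      ¬ Adj G x y → i ≡ j
  class-nonadjacent {i} {j} (x∈AB , ri∼x) (y∈AB , rj∼y) x≁y =
    distinct i j (ri∼x ◅◅ C1 x∈AB y∈AB x≁y ◅ ∼-sym rj∼y)

  class-sclass-adjacent : ∀ {i j x y} → InClass G sp (r i) x → InSClass G sp (r j) y →
                          Adj G x y → i ≡ j
  class-sclass-adjacent {i} {j} (x∈AB , ri∼x)
                        (y∈S , y′ , z′ , (y′∈AB , rj∼y′) , z′∈S , y′~z′ , z′⇝y) x~y =
    distinct i j (ri∼x ◅◅ C2 x∈AB y′∈AB x~y y∈S (reverse SEdge-sym z′⇝y) z′∈S (Graph.sym G y′~z′)
                       ◅ ∼-sym rj∼y′)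

  sclass-linked : ∀ {i j x x′} → InSClass G sp (r i) x → InSClass G sp (r j) x′ →
                  Star (SEdge G sp) x x′ → i ≡ j
  sclass-linked {i} {j} (_ , y , z , (y∈AB , ri∼y) , z∈S , y~z , z⇝x)
                        (_ , y′ , z′ , (y′∈AB , rj∼y′) , z′∈S , y′~z′ , z′⇝x′) x⇝x′ =
    distinct i j (ri∼y ◅◅ C2 y∈AB y′∈AB y~z z∈S (z⇝x ◅◅ x⇝x′ ◅◅ reverse SEdge-sym z′⇝x′) z′∈S
                             (Graph.sym G y′~z′)
                       ◅ ∼-sym rj∼y′)

  home-unique : ∀ {i j x} → Home i x → Home j x → i ≡ j
  home-unique (inj₁ x∈Φi)       (inj₁ x∈Φj)       = class-unique x∈Φi x∈Φj
  home-unique (inj₁ (x∈AB , _)) (inj₂ (x∈S , _))  = ⊥-elim (AB-disjoint-S x∈AB x∈S)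
  home-unique (inj₂ (x∈S , _))  (inj₁ (x∈AB , _)) = ⊥-elim (AB-disjoint-S x∈AB x∈S)
  home-unique (inj₂ x∈sΦi)      (inj₂ x∈sΦj)      = sclass-linked x∈sΦi x∈sΦj ε

  home-cross-adjacent : ∀ {i j x y} → i ≢ j → Home i x → Home j y → Adj G x y →
                        InClass G sp (r i) x × InClass G sp (r j) y
  home-cross-adjacent i≢j (inj₁ x∈Φi)  (inj₁ y∈Φj)  x~y = x∈Φi , y∈Φj
  home-cross-adjacent i≢j (inj₁ x∈Φi)  (inj₂ y∈sΦj) x~y =
    ⊥-elim (i≢j (class-sclass-adjacent x∈Φi y∈sΦj x~y))
  home-cross-adjacent i≢j (inj₂ x∈sΦi) (inj₁ y∈Φj)  x~y =
    ⊥-elim (i≢j (sym (class-sclass-adjacent y∈Φj x∈sΦi (Graph.sym G x~y))))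
  home-cross-adjacent i≢j (inj₂ x∈sΦi) (inj₂ y∈sΦj) x~y =
    ⊥-elim (i≢j (sclass-linked x∈sΦi y∈sΦj ((proj₁ x∈sΦi , proj₁ y∈sΦj , x~y) ◅ ε)))

  home-of-exit : ∀ {x} → inS G sp x → ExitToAB x → ∃ λ i → Home i x
  home-of-exit x∈S (z , y , x⇝z , z∈S , z~y , y∈AB) =
    map₂ (λ ri∼y → inj₂ (x∈S , y , z , (y∈AB , ri∼y) , z∈S , Graph.sym G z~y , reverse SEdge-sym x⇝z))
         (covers y y∈AB)

  home-exists : Connected G → ∀ x → ∃ λ i → Home i x
  home-exists connected x = home-by-part (part sp x) refl
    where
    home-by-part : ∀ p → part sp x ≡ p → ∃ λ i → Home i x
    home-by-part pA  x∈A  = map₂ (λ ri∼x → inj₁ (inj₁ x∈A , ri∼x)) (covers x (inj₁ x∈A))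
    home-by-part pB  x∈B  = map₂ (λ ri∼x → inj₁ (inj₂ x∈B , ri∼x)) (covers x (inj₂ x∈B))
    home-by-part psA x∈sA =
      let b , _ , _ , b∈B∪sB , _ = sizeB sp
      in home-of-exit (inj₁ x∈sA) (exit (inj₁ x∈sA) (connected x b) (SideB-≢-psA b∈B∪sB ∘ flip trans x∈sA))
    home-by-part psB x∈sB =
      let a , _ , _ , a∈A∪sA , _ = sizeA sp
      in home-of-exit (inj₂ x∈sB) (exit (inj₂ x∈sB) (connected x a) (SideA-≢-psB a∈A∪sA ∘ flip trans x∈sB))

module Combination {n} {G : Graph n} {sp : Split G} {ℓ} {r : Fin ℓ → Fin n}
  (classes : ClassEnumeration G sp ℓ r)
  (adj? : ∀ u v → Dec (Adj G u v))
  (home : ∀ x → ∃ λ i → Classes.Home classes i x)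
  (τ τ̂ : Fin ℓ → List (Fin n))
  (reps : ∀ i → CircleRep Maybe≟ (GiVert G sp (r i)) (GiAdj G sp (r i)) (wordGi (τ i) (τ̂ i)))
  where

  open Classes classes
  open CircleRep

  W : List (Fin n)
  W = combined τ τ̂

  occ-home : ∀ {i x} → Home i x → occ _≟_ x (τ i ++ τ̂ i) ≡ 2
  occ-home {i} {x} x∈Gi = trans (sym (occ-wordGi x (τ i) (τ̂ i))) (occ-in (reps i) (just x) x∈Gi)

  occ-away : ∀ {i x} → Home i x → ∀ k → k ≢ i → occ _≟_ x (τ k) ≡ 0 × occ _≟_ x (τ̂ k) ≡ 0
  occ-away {i} {x} x∈Gi k k≢i = m+n≡0⇒m≡0 _ total , m+n≡0⇒n≡0 _ total
    where
    total : occ _≟_ x (τ k) + occ _≟_ x (τ̂ k) ≡ 0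
    total = trans (sym (occ-++ _≟_ x (τ k) (τ̂ k)))
           (trans (sym (occ-wordGi x (τ k) (τ̂ k)))
                  (occ-out (reps k) (just x) λ x∈Gk → k≢i (home-unique x∈Gk x∈Gi)))

  occ-W : ∀ {i x} → Home i x → occ _≟_ x W ≡ 2
  occ-W {i} {x} x∈Gi = begin
    occ _≟_ x (concat (tabulate τ) ++ concat (tabulate τ̂))              ≡⟨ occ-++ _≟_ x (concat (tabulate τ)) _ ⟩
    occ _≟_ x (concat (tabulate τ)) + occ _≟_ x (concat (tabulate τ̂))
      ≡⟨ cong₂ _+_ (occ-concat-tabulate-single _≟_ τ i x (proj₁ ∘₂ occ-away x∈Gi))
                   (occ-concat-tabulate-single _≟_ τ̂ i x (proj₂ ∘₂ occ-away x∈Gi)) ⟩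
    occ _≟_ x (τ i) + occ _≟_ x (τ̂ i)                                   ≡⟨ occ-++ _≟_ x (τ i) (τ̂ i) ⟨
    occ _≟_ x (τ i ++ τ̂ i)                                              ≡⟨ occ-home x∈Gi ⟩
    2                                                                  ∎
    where open ≡-Reasoning

  class⇔once : ∀ {i x} → Home i x → InClass G sp (r i) x ⇔ occ _≟_ x (τ i) ≡ 1
  class⇔once {i} {x} x∈Gi = begin
    InClass G sp (r i) x                                    ∼⟨ adj-alt (reps i) nothing (just x) tt x∈Gi (λ ()) ⟩
    Alternate Maybe≟ nothing (just x) (wordGi (τ i) (τ̂ i))
      ∼⟨ alternate⇔gap Maybe≟ [] (map just (τ i)) (map just (τ̂ i)) refl (occ-in (reps i) nothing tt) ⟩
    occ Maybe≟ (just x) (map just (τ i)) ≡ 1                ≡⟨ cong (_≡ 1) (occ-map _≟_ Maybe≟ just-injective x (τ i)) ⟩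
    occ _≟_ x (τ i) ≡ 1                                     ∎
    where open EquationalReasoning

  filter-W : ∀ {p} {P : Pred (Fin n) p} (P? : Decidable P) →
             filter P? W ≡ concat (tabulate (filter P? ∘ τ)) ++ concat (tabulate (filter P? ∘ τ̂))
  filter-W P? = trans (filter-++ P? (concat (tabulate τ)) _)
                      (cong₂ _++_ (filter-concat-tabulate P? τ) (filter-concat-tabulate P? τ̂))

  pair-absent-elsewhere : ∀ {i j u v} → Home i u → Home j v → ∀ k → k ≢ i → k ≢ j →
                          filter (isEither? _≟_ u v) (τ k) ≡ [] × filter (isEither? _≟_ u v) (τ̂ k) ≡ []
  pair-absent-elsewhere {u = u} {v} u∈Gi v∈Gj k k≢i k≢j =
    filter-isEither-absent _≟_ u v (τ k) (proj₁ u-away) (proj₁ v-away) ,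
    filter-isEither-absent _≟_ u v (τ̂ k) (proj₂ u-away) (proj₂ v-away)
    where
    u-away = occ-away u∈Gi k k≢i
    v-away = occ-away v∈Gj k k≢j

  same-home : ∀ {i u v} → u ≢ v → Home i u → Home i v → Adj G u v ⇔ Alternate _≟_ u v W
  same-home {i} {u} {v} u≢v u∈Gi v∈Gi = begin
    Adj G u v
      ∼⟨ adj-alt (reps i) (just u) (just v) u∈Gi v∈Gi (u≢v ∘ just-injective) ⟩
    Alternate Maybe≟ (just u) (just v) (wordGi (τ i) (τ̂ i))
      ∼⟨ alternate-filter Maybe≟ nonNothing? (wordGi (τ i) (τ̂ i)) (λ ()) (λ ()) (occ-in (reps i) (just u) u∈Gi) ⟩
    Alternate Maybe≟ (just u) (just v) (filter nonNothing? (wordGi (τ i) (τ̂ i)))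
      ≡⟨ cong (Alternate Maybe≟ (just u) (just v)) (filter-wordGi (τ i) (τ̂ i)) ⟩
    Alternate Maybe≟ (just u) (just v) (map just (τ i ++ τ̂ i))
      ∼⟨ alternate-map _≟_ Maybe≟ just-injective u v (τ i ++ τ̂ i) (occ-home u∈Gi) ⟩
    Alternate _≟_ u v (τ i ++ τ̂ i)
      ∼⟨ alternate-filter _≟_ P? (τ i ++ τ̂ i) (inj₁ refl) (inj₂ refl) (occ-home u∈Gi) ⟩
    Alternate _≟_ u v (filter P? (τ i ++ τ̂ i))
      ≡⟨ cong (Alternate _≟_ u v) restricted-W ⟨
    Alternate _≟_ u v (filter P? W)
      ∼⟨ ⇔-sym (alternate-filter _≟_ P? W (inj₁ refl) (inj₂ refl) (occ-W u∈Gi)) ⟩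
    Alternate _≟_ u v W ∎
    where
    open EquationalReasoning
    P? = isEither? _≟_ u v
    away : ∀ k → k ≢ i → filter P? (τ k) ≡ [] × filter P? (τ̂ k) ≡ []
    away k k≢i = pair-absent-elsewhere u∈Gi v∈Gi k k≢i k≢i
    restricted-W : filter P? W ≡ filter P? (τ i ++ τ̂ i)
    restricted-W = trans (filter-W P?)
      (trans (cong₂ _++_ (concat-tabulate-single _ i (proj₁ ∘₂ away))
                         (concat-tabulate-single _ i (proj₂ ∘₂ away)))
             (sym (filter-++ P? (τ i) (τ̂ i))))

  -- Rule (C1) only says that non-adjacent vertices are equivalent; turning it into
  -- adjacency of inequivalent vertices needs adjacency in G to be decidable.
  classes-adjacent : ∀ {i j u v} → i ≢ j → InClass G sp (r i) u → InClass G sp (r j) v → Adj G u v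
  classes-adjacent {u = u} {v} i≢j u∈Φi v∈Φj = case adj? u v of λ where
    (yes u~v) → u~v
    (no u≁v)  → ⊥-elim (i≢j (class-nonadjacent u∈Φi v∈Φj u≁v))

  cross-adjacency : ∀ {i j u v} → i ≢ j → Home i u → Home j v →
                    Adj G u v ⇔ (occ _≟_ u (τ i) ≡ 1 × occ _≟_ v (τ j) ≡ 1)
  cross-adjacency i≢j u∈Gi v∈Gj =
    ⇔-trans (mk⇔ (home-cross-adjacent i≢j u∈Gi v∈Gj)
                 λ (u∈Φi , v∈Φj) → classes-adjacent i≢j u∈Φi v∈Φj)
            (class⇔once u∈Gi ×-⇔ class⇔once v∈Gj)

  cross-alternation : ∀ {i j u v} → i ≢ j → Home i u → Home j v →
                      Alternate _≟_ u v W ⇔ (occ _≟_ u (τ i) ≡ 1 × occ _≟_ v (τ j) ≡ 1)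
  cross-alternation {i} {j} {u} {v} i≢j u∈Gi v∈Gj =
    ⇔-trans (alternate-filter _≟_ P? W (inj₁ refl) (inj₂ refl) (occ-W u∈Gi)) (by-order (<-cmp i j))
    where
    P? = isEither? _≟_ u v
    a = occ _≟_ u (τ i) ; b = occ _≟_ u (τ̂ i) ; c = occ _≟_ v (τ j) ; d = occ _≟_ v (τ̂ j)
    a+b≡2 : a + b ≡ 2
    a+b≡2 = trans (sym (occ-++ _≟_ u (τ i) (τ̂ i))) (occ-home u∈Gi)
    c+d≡2 : c + d ≡ 2
    c+d≡2 = trans (sym (occ-++ _≟_ v (τ j) (τ̂ j))) (occ-home v∈Gj)
    u-blocks : filter P? (τ i) ≡ replicate a u × filter P? (τ̂ i) ≡ replicate b u
    u-blocks = let v-away = occ-away v∈Gj i i≢j in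
      filter-isEither-left _≟_ u v (τ i) (proj₁ v-away) , filter-isEither-left _≟_ u v (τ̂ i) (proj₂ v-away)
    v-blocks : filter P? (τ j) ≡ replicate c v × filter P? (τ̂ j) ≡ replicate d v
    v-blocks = let u-away = occ-away u∈Gi j (i≢j ∘ sym) in
      filter-isEither-right _≟_ u v (τ j) (proj₁ u-away) , filter-isEither-right _≟_ u v (τ̂ j) (proj₂ u-away)
    τ-away : ∀ k → k ≢ i → k ≢ j → filter P? (τ k) ≡ []
    τ-away k k≢i k≢j = proj₁ (pair-absent-elsewhere u∈Gi v∈Gj k k≢i k≢j)
    τ̂-away : ∀ k → k ≢ i → k ≢ j → filter P? (τ̂ k) ≡ []
    τ̂-away k k≢i k≢j = proj₂ (pair-absent-elsewhere u∈Gi v∈Gj k k≢i k≢j)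
    via : ∀ {w X} → filter P? W ≡ w → (occ _≟_ u w ≡ 2 → Alternate _≟_ u v w ⇔ X) →
          Alternate _≟_ u v (filter P? W) ⇔ X
    via {X = X} e characterisation = subst (λ w → Alternate _≟_ u v w ⇔ X) (sym e)
      (characterisation (subst (λ w → occ _≟_ u w ≡ 2) e
                               (trans (occ-filter _≟_ P? W (inj₁ refl)) (occ-W u∈Gi))))
    by-order : Tri (i < j) (i ≡ j) (j < i) → Alternate _≟_ u v (filter P? W) ⇔ (a ≡ 1 × c ≡ 1)
    by-order (tri< i<j _ _) = via
      (trans (filter-W P?) (cong₂ _++_
        (trans (concat-tabulate-pair _ i<j τ-away) (cong₂ _++_ (proj₁ u-blocks) (proj₁ v-blocks)))
        (trans (concat-tabulate-pair _ i<j τ̂-away) (cong₂ _++_ (proj₂ u-blocks) (proj₂ v-blocks)))))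
      (alternate-uᵃvᶜ-uᵇvᵈ _≟_ a b c d a+b≡2)
    by-order (tri≈ _ i≡j _) = ⊥-elim (i≢j i≡j)
    by-order (tri> _ _ j<i) = via
      (trans (filter-W P?) (cong₂ _++_
        (trans (concat-tabulate-pair _ j<i (flip ∘ τ-away)) (cong₂ _++_ (proj₁ v-blocks) (proj₁ u-blocks)))
        (trans (concat-tabulate-pair _ j<i (flip ∘ τ̂-away)) (cong₂ _++_ (proj₂ v-blocks) (proj₂ u-blocks)))))
      (alternate-vᶜuᵃ-vᵈuᵇ _≟_ a b c d a+b≡2 c+d≡2)

  adjacent⇔alternate : ∀ {u v} → u ≢ v → Adj G u v ⇔ Alternate _≟_ u v W
  adjacent⇔alternate {u} {v} u≢v with home u | home v
  ... | i , u∈Gi | j , v∈Gj = case i ≟ j of λ where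
    (yes refl) → same-home u≢v u∈Gi v∈Gj
    (no i≢j)   → ⇔-trans (cross-adjacency i≢j u∈Gi v∈Gj) (⇔-sym (cross-alternation i≢j u∈Gi v∈Gj))

  circleRep : CircleRep _≟_ (λ _ → ⊤) (Adj G) W
  circleRep = record
    { occ-in  = λ x _ → occ-W (proj₂ (home x))
    ; occ-out = λ _ x∉V → ⊥-elim (x∉V tt)
    ; adj-alt = λ _ _ _ _ → adjacent⇔alternate
    }

mainTheorem3 : ∀ {n} (G : Graph n) → Connected G → IsCircleGraph G →
    (sp : Split G) → (ℓ : ℕ) (r : Fin ℓ → Fin n) → ClassEnumeration G sp ℓ r →
    (τ τ̂ : Fin ℓ → List (Fin n)) →
    (∀ i → CircleRep Maybe≟ (GiVert G sp (r i)) (GiAdj G sp (r i)) (wordGi (τ i) (τ̂ i))) →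
    CircleRep _≟_ (λ _ → ⊤) (Adj G) (combined τ τ̂)
mainTheorem3 G connected (_ , circle) sp ℓ r classes τ τ̂ reps =
  Combination.circleRep classes
    (λ u v → adjacency? _≟_ circle (Graph.irrefl G) tt tt)
    (Classes.home-exists classes connected)
    τ τ̂ reps
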